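{- Let $\mathcal L$ be either of the languages $\mathcal L^+$ or $\mathcal L^-$, and let $(\mathcal C,Y)$ and $(\mathcal C',Y')$ be pointed simplicial models. Suppose that for every formula $\varphi\in\mathcal L$, $$\mathcal C,Y\vDash\varphi \iff \mathcal C',Y'\vDash\varphi.$$ Then $(\mathcal C,Y)\equiv_{\mathcal L}(\mathcal C',Y')$, i.e. in addition, for every $\varphi\in\mathcal L$, $\mathcal C,Y\bowtie\varphi\iff\mathcal C',Y'\bowtie\varphi$ and $\mathcal C,Y\vDash\neg\varphi\iff\mathcal C',Y'\vDash\neg\varphi$.
   Context: Let $A$ be a finite set of agents and $P=A\sqcup\bigsqcup_{a\in A}P_a$, where the $P_a$ are countable, pairwise disjoint sets of local atoms for agent $a$ (disjoint from $A$); each $a\in A$ is also used as a global atom meaning "agent $a$ is alive". The language $\mathcal L^+$ is given by $\varphi::=a\mid p_a\mid\neg\varphi\mid(\varphi\wedge\varphi)\mid\widehat K_a\varphi$ with $a\in A$, $p_a\in P_a$; $\mathcal L^-$ is its fragment without global atoms. $K_a\varphi:=\neg\widehat K_a\neg\varphi$. A simplicial model $\mathcal C=(C,\chi,\ell)$ consists of a nonempty set $C$ of nonempty finite subsets (simplexes) of a vertex set $\mathcal V$, closed under taking nonempty subsets and containing $\{v\}$ for every $v\in\mathcal V$; a map $\chi:\mathcal V\to A$ injective on every simplex; and a map $\ell:\mathcal V\to 2^{P\setminus A}$ with $\ell(v)\subseteq P_{\chi(v)}$. For a simplex $X$, $\chi(X)=\{\chi(v)\mid v\in X\}$ and $\ell(X)=\bigcup_{v\in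 X}\ell(v)$. Facets are maximal simplexes; $\mathcal F(C)$ is the set of facets. A pointed simplicial model is $(\mathcal C,X)$ with $X\in\mathcal F(C)$. Definability $\bowtie$ and satisfaction $\vDash$ at a facet $X$: $\mathcal C,X\bowtie a$ always; $\mathcal C,X\bowtie p_a$ iff $a\in\chi(X)$; $\mathcal C,X\bowtie\neg\varphi$ iff $\mathcal C,X\bowtie\varphi$; $\mathcal C,X\bowtie\varphi\wedge\psi$ iff both are defined; $\mathcal C,X\bowtie\widehat K_a\varphi$ iff $\mathcal C,Y\bowtie\varphi$ for some $Y\in\mathcal F(C)$ with $a\in\chi(X\cap Y)$. $\mathcal C,X\vDash a$ iff $a\in\chi(X)$; $\mathcal C,X\vDash p_a$ iff $p_a\in\ell(X)$; $\mathcal C,X\vDash\neg\varphi$ iff $\mathcal C,X\bowtie\varphi$ and $\mathcal C,X\nvDash\varphi$; $\mathcal C,X\vDash\varphi\wedge\psi$ iff both hold; $\mathcal C,X\vDash\widehat K_a\varphi$ iff $\mathcal C,Y\vDash\varphi$ for some $Y\in\mathcal F(C)$ with $a\in\chi(X\cap Y)$. $(\mathcal C,Y)\equiv_{\mathcal L}(\mathcal C',Y')$ (modal equivalence in $\mathcal L$) means that for every $\varphi\in\mathcal L$: $\mathcal C,Y\bowtie\varphi\iff\mathcal C',Y'\bowtie\varphi$; $\mathcal C,Y\vDash\varphi\iff\mathcal C',Y'\vDash\varphi$; and $\mathcal C,Y\vDash\neg\varphi\iff\mathcal C',Y'\vDash\neg\varphi$. -}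

module Defs where

open import Data.Nat using (ℕ)
open import Data.Fin using (Fin)
open import Data.List using (List; []; [_])
open import Data.List.Membership.Propositional using (_∈_)
open import Data.List.Relation.Binary.Subset.Propositional using (_⊆_)
open import Data.Product using (Σ; ∃; ∃-syntax; _×_; _,_)
open import Relation.Nullary using (¬_)
open import Relation.Binary.PropositionalEquality using (_≡_; _≢_)
open import Function.Bundles using (_↣_; _⇔_)
open import Data.Unit using (⊤)

-- The sets P_a are disjoint from each other and from A automatically,
-- since atoms are tagged by their agent in the syntax below.

record Signature : Set₁ where
  field
    n         : ℕ
    Atom      : Fin n → Set
    countable : (a : Fin n) → Atom a ↣ ℕ

open Signature public

Agent : Signature → Set
Agent S = Fin (n S)

data Lang : Set where
  L⁺ L⁻ : Lang

data Form (S : Signature) : Lang → Set where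
  alive : (a : Agent S) → Form S L⁺
  loc   : ∀ {L} (a : Agent S) → Atom S a → Form S L
  ¬′_   : ∀ {L} → Form S L → Form S L
  _∧′_  : ∀ {L} → Form S L → Form S L → Form S L
  K̂     : ∀ {L} → Agent S → Form S L → Form S L

-- Finite subsets of the vertex set V are represented
-- by lists of vertices; simplexes are given by a predicate on lists which,
-- by downward closure w.r.t. ⊆ (membership inclusion), is invariant under
-- permutation / duplication, i.e. really a predicate on finite sets.

record SimplicialModel (S : Signature) : Set₁ where
  field
    V        : Set
    C        : List V → Set
    C-inhabited : ∃[ X ] C X
    C-nonempty  : ∀ {X} → C X → X ≢ []
    C-downward  : ∀ {X Y} → C X → Y ⊆ X → Y ≢ [] → C Y
    C-vertex    : ∀ v → C [ v ]
    χ        : V → Agent S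
    χ-inj    : ∀ {X v w} → C X → v ∈ X → w ∈ X → χ v ≡ χ w → v ≡ w
    -- ℓ v a p : "p ∈ ℓ(v)" for p ∈ P_a; we require ℓ(v) ⊆ P_{χ(v)}
    ℓ        : V → (a : Agent S) → Atom S a → Set
    ℓ-local  : ∀ {v a p} → ℓ v a p → χ v ≡ a

module _ {S : Signature} (𝓒 : SimplicialModel S) where
  open SimplicialModel 𝓒

  Facet : List V → Set
  Facet X = C X × (∀ Y → C Y → X ⊆ Y → Y ⊆ X)

  _∈χ_ : Agent S → List V → Set
  a ∈χ X = ∃[ v ] (v ∈ X × χ v ≡ a)

  _∈χ∩_,_ : Agent S → List V → List V → Set
  a ∈χ∩ X , Y = ∃[ v ] (v ∈ X × v ∈ Y × χ v ≡ a)

  _∈ℓ_ : ∀ {a} → Atom S a → List V → Set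
  _∈ℓ_ {a} p X = ∃[ v ] (v ∈ X × ℓ v a p)

  _⋈_ : ∀ {L} → List V → Form S L → Set
  X ⋈ alive a   = ⊤
  X ⋈ loc a p   = a ∈χ X
  X ⋈ (¬′ φ)    = X ⋈ φ
  X ⋈ (φ ∧′ ψ)  = X ⋈ φ × X ⋈ ψ
  X ⋈ K̂ a φ     = ∃[ Y ] (Facet Y × a ∈χ∩ X , Y × Y ⋈ φ)

  _⊨_ : ∀ {L} → List V → Form S L → Set
  X ⊨ alive a   = a ∈χ X
  X ⊨ loc a p   = p ∈ℓ X
  X ⊨ (¬′ φ)    = X ⋈ φ × ¬ (X ⊨ φ)
  X ⊨ (φ ∧′ ψ)  = X ⊨ φ × X ⊨ ψ
  X ⊨ K̂ a φ     = ∃[ Y ] (Facet Y × a ∈χ∩ X , Y × Y ⊨ φ)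

record Pointed (S : Signature) : Set₁ where
  constructor _,_⟨_⟩
  field
    model : SimplicialModel S
    point : List (SimplicialModel.V model)
    facet : Facet model point

module _ {S : Signature} (P P′ : Pointed S) where
  open Pointed P using () renaming (model to 𝓒 ; point to Y)
  open Pointed P′ using () renaming (model to 𝓒′ ; point to Y′)

  SatAgree : Lang → Set
  SatAgree L = (φ : Form S L) → (_⊨_ 𝓒 Y φ ⇔ _⊨_ 𝓒′ Y′ φ)

  ModalEquiv : Lang → Set
  ModalEquiv L = (φ : Form S L) →
      (_⋈_ 𝓒 Y φ ⇔ _⋈_ 𝓒′ Y′ φ)
    × (_⊨_ 𝓒 Y φ ⇔ _⊨_ 𝓒′ Y′ φ)
    × (_⊨_ 𝓒 Y (¬′ φ) ⇔ _⊨_ 𝓒′ Y′ (¬′ φ))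

{-# OPTIONS --safe #-}
module Submission where

open import Defs
open import Data.Product using (_,_; proj₁)
open import Data.List using (List)
open import Function.Base using (_∘_)
open import Function.Bundles using (_⇔_; mk⇔)
open import Function.Properties.Equivalence using (trans; sym)

-- Definedness is expressible by satisfaction: the negated contradiction
-- ¬(φ ∧ ¬φ) is defined exactly where φ is, and is then always true.
defined : ∀ {S L} → Form S L → Form S L
defined φ = ¬′ (φ ∧′ (¬′ φ))

module _ {S : Signature} (𝓒 : SimplicialModel S) where
  open SimplicialModel 𝓒 using (V)

  ⋈⇔⊨-defined : ∀ {L} {X : List V} (φ : Form S L) →
    _⋈_ 𝓒 X φ ⇔ _⊨_ 𝓒 X (defined φ)
  ⋈⇔⊨-defined φ = mk⇔ (λ d → (d , d) , λ { (s , _ , ¬s) → ¬s s }) (proj₁ ∘ proj₁)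

SatAgree⇒⋈-agree : ∀ {S} {L} (P P′ : Pointed S) → SatAgree P P′ L →
  (φ : Form S L) → _⋈_ (Pointed.model P) (Pointed.point P) φ
                 ⇔ _⋈_ (Pointed.model P′) (Pointed.point P′) φ
SatAgree⇒⋈-agree P P′ agree φ =
  trans (⋈⇔⊨-defined (Pointed.model P) φ)
    (trans (agree (defined φ)) (sym (⋈⇔⊨-defined (Pointed.model P′) φ)))

lemma3p2 : {S : Signature} (L : Lang) (P P′ : Pointed S) →
    SatAgree P P′ L → ModalEquiv P P′ L
lemma3p2 L P P′ agree φ = SatAgree⇒⋈-agree P P′ agree φ , agree φ , agree (¬′ φ)
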